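{- Let $H$ be a $k$-absorber with absorbing part $Q(H)$, and let $X,Y\subseteq Q(H)$ be two vertex sets of size $2k$ that each induce a transitive tournament. Then $H$ contains the $k$-th power of a Hamilton path whose first $k$ vertices are in $Y$ and whose last $k$ vertices are in $X$.
   Context: A tournament is a complete graph with every edge oriented; it is transitive if its vertices can be ordered so that all edges go from earlier to later vertices. We write $A\Rightarrow B$ if $A$ and $B$ are disjoint and every vertex of $A$ has an edge oriented to every vertex of $B$ (for a single vertex $q$ we write $q$ for $\{q\}$). A tournament $H$ is a $k$-absorber if there is a set $Q=\{q_1,\dots,q_{r'}\}$ and a partition $V(H)=S_0\cup\dots\cup S_r\cup Q$ such that: (i) $|Q|=r'=2^{10k}$ and $r>r'$; (ii) $S_0\Rightarrow S_1\Rightarrow\cdots\Rightarrow S_r\Rightarrow S_0$, and each $S_i$ induces a transitive tournament of size $2k$; (iii) $S_0\Rightarrow Q\Rightarrow S_{r'+1}$, and $S_i\Rightarrow q_i\Rightarrow S_{i+1}$ for $i\in[r']$. The set $Q=Q(H)$ is called the absorbing part of $H$. The $k$-th power of a path is a sequence of distinct vertices $x_1,\dots,x_n$ with $x_i\to x_j$ for all $1\le i<j\le i+k\le n$; it is Hamilton in $H$ if it uses all vertices of $H$. -}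

module Defs where

open import Data.Nat using (ℕ; zero; suc; _+_; _*_; _^_; _≤_; _<_)
open import Data.Fin using (Fin; toℕ)
open import Data.Fin.Subset using (Subset; _∈_; _∉_; _⊆_; ∣_∣; ⁅_⁆)
open import Data.Product using (Σ; ∃; _×_; _,_)
open import Data.Sum using (_⊎_)
open import Data.Empty using (⊥)
open import Relation.Nullary using (¬_)
open import Relation.Binary.PropositionalEquality using (_≡_; _≢_)
open import Function.Definitions using (Injective; Surjective)

record Tournament (n : ℕ) : Set₁ where
  field
    _⟶_     : Fin n → Fin n → Set
    irrefl  : ∀ v → ¬ (v ⟶ v)
    total   : ∀ u v → u ≢ v → (u ⟶ v) ⊎ (v ⟶ u)
    antisym : ∀ u v → ¬ ((u ⟶ v) × (v ⟶ u))
open Tournament public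

module _ {n : ℕ} (T : Tournament n) where

  _⇒_ : Subset n → Subset n → Set
  A ⇒ B = (∀ v → v ∈ A → v ∉ B) × (∀ u v → u ∈ A → v ∈ B → _⟶_ T u v)

  InducesTransitive : Subset n → Set
  InducesTransitive A =
    Σ (Fin ∣ A ∣ → Fin n) λ e →
      Injective _≡_ _≡_ e
      × (∀ i → e i ∈ A)
      × (∀ v → v ∈ A → ∃ λ i → e i ≡ v)
      × (∀ i j → toℕ i < toℕ j → _⟶_ T (e i) (e j))

  image : {m : ℕ} → (Fin m → Fin n) → Subset n → Set
  image q A = ∀ v → v ∈ A → ∃ λ j → q j ≡ v

  -- k-absorber structure on T.  S i is S_i (meaningful for i ≤ r);
  -- q j (j : Fin r') is q_{j+1}.
  record Absorber (k : ℕ) : Set where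
    field
      r        : ℕ
      S        : ℕ → Subset n
      q        : Fin (2 ^ (10 * k)) → Fin n
      q-inj    : Injective _≡_ _≡_ q
      r'<r     : 2 ^ (10 * k) < r
      cover    : ∀ v → (∃ λ i → i ≤ r × v ∈ S i) ⊎ (∃ λ j → q j ≡ v)
      S-disj   : ∀ i j v → i ≤ r → j ≤ r → v ∈ S i → v ∈ S j → i ≡ j
      SQ-disj  : ∀ i j → i ≤ r → q j ∉ S i
      S-size   : ∀ i → i ≤ r → ∣ S i ∣ ≡ 2 * k
      S-trans  : ∀ i → i ≤ r → InducesTransitive (S i)
      S-chain  : ∀ i → i < r → S i ⇒ S (suc i)
      S-close  : S r ⇒ S 0
      S₀⇒Q     : ∀ j → S 0 ⇒ ⁅ q j ⁆
      Q⇒S      : ∀ j → ⁅ q j ⁆ ⇒ S (suc (2 ^ (10 * k)))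
      Sᵢ⇒qᵢ    : ∀ j → S (suc (toℕ j)) ⇒ ⁅ q j ⁆
      qᵢ⇒Sᵢ₊₁  : ∀ j → ⁅ q j ⁆ ⇒ S (suc (suc (toℕ j)))

    QSet : Subset n → Set
    QSet A = image q A

  IsHamiltonPathPower : ℕ → (Fin n → Fin n) → Set
  IsHamiltonPathPower k x =
    Injective _≡_ _≡_ x × Surjective _≡_ _≡_ x
    × (∀ i j → toℕ i < toℕ j → toℕ j ≤ toℕ i + k → _⟶_ T (x i) (x j))

-- Let S₀ ⇒ S₁ ⇒ ⋯ ⇒ S_r ⇒ S₀ be the cycle of the absorber, R = 2^(10k) = |Q|, and split each S_i
-- into its lower half L_i and upper half U_i (first and last k vertices in its transitive order).
-- Let Y₀ be the first k vertices of Y and X₀ the first k vertices of X ∖ Y₀. The path goes round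
-- the cycle twice, starting just after the absorbing stretch S₁ … S_R:
--   Y₀, L_{R+1}, …, L_r, L₀, S₁ q₁, S₂ q₂, …, S_R q_R, U_{R+1}, …, U_r, U₀, X₀,
-- where q_i is left out when it lies in Y₀ ∪ X₀. Every block is transitive, has at least k vertices
-- and beats the first k vertices of the next block (Q ⇒ S_{R+1}, S_i ∪ {q_i} ⇒ S_{i+1}, S_r ⇒ S₀ ⇒ Q),
-- so the concatenation is the k-th power of a path, and it meets every vertex exactly once.

module Submission where

open import Defs
open import Data.Nat using (ℕ; zero; suc; _+_; _*_; _∸_; _^_; _≤_; _<_; z≤n; s≤s; s≤s⁻¹; _≤?_; _<?_)
open import Data.Nat.Properties
open import Data.Fin as Fin using (Fin; toℕ; cast; fromℕ<; splitAt; _↑ˡ_; _↑ʳ_)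
import Data.Fin.Properties as Finₚ
open import Data.Fin.Subset using (Subset; ∣_∣)
open import Data.Fin.Subset.Properties using (x∈⁅x⁆)
open import Data.List using (List; []; _∷_; _++_; take; length; lookup; map; tabulate; filter; concat; applyUpTo)
open import Data.List.Properties
  using (take-map; length-tabulate; length-map; length-take; length-++; length-++-≤ˡ; map-++; concat-++; ++-assoc; ++-identityʳ)
open import Data.List.Membership.Propositional.Properties
  using (∈-lookup; ∈-map⁺; ∈-map⁻; ∈-++⁺ˡ; ∈-++⁺ʳ; ∈-++⁻; ∈-tabulate⁺; ∈-tabulate⁻; ∈-filter⁺; ∈-filter⁻;
         ∈-applyUpTo⁺; ∈-applyUpTo⁻; ∈-concat⁺′; ∈-concat⁻′; ∈-allFin)
import Data.List.Membership.DecPropositional as DecMembership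
open import Data.List.Relation.Unary.Any using (here; there; index)
open import Data.List.Relation.Unary.Any.Properties using (lookup-index)
open import Data.List.Relation.Unary.All as All using (All; []; _∷_)
import Data.List.Relation.Unary.All.Properties as Allₚ
open import Data.List.Relation.Unary.AllPairs as AllPairs using (AllPairs; []; _∷_)
import Data.List.Relation.Unary.AllPairs.Properties as AllPairsₚ
open import Data.List.Relation.Unary.Linked using (Linked; []; [-]; _∷_)
import Data.List.Relation.Unary.Linked.Properties as Linkedₚ
open import Data.List.Relation.Unary.Unique.Propositional using (Unique)
import Data.List.Relation.Unary.Unique.Propositional.Properties as Uniqueₚ
open import Data.List.Relation.Binary.Disjoint.Propositional using (Disjoint)
open import Data.List.Relation.Binary.Subset.Propositional using (_⊆_)
open import Data.List.Relation.Binary.Sublist.Propositional.Properties using (take-⊆; Any-resp-⊆)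
open import Data.Product using (Σ; ∃; _×_; _,_; proj₁; proj₂)
open import Data.Sum using (_⊎_; inj₁; inj₂)
open import Data.Unit using (⊤; tt)
open import Data.Empty using (⊥-elim)
open import Function using (_∘_; id)
open import Function.Definitions using (Injective; Surjective)
open import Relation.Nullary using (Dec; yes; no; contradiction; ¬?; _×-dec_)
open import Relation.Binary.PropositionalEquality

module _ {A : Set} where

  open import Data.List.Membership.Propositional using (_∈_)

  ∈-take : ∀ {x : A} m {xs} → x ∈ take m xs → x ∈ xs
  ∈-take m {xs} = Any-resp-⊆ (take-⊆ m xs)

  ∈-take-suc : ∀ {x : A} m {xs} → x ∈ take m xs → x ∈ take (suc m) xs
  ∈-take-suc (suc m) {_ ∷ _} (here p)  = here p
  ∈-take-suc (suc m) {_ ∷ _} (there p) = there (∈-take-suc m p)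

  ∈-take-++⁻ : ∀ {x : A} m xs {ys} → x ∈ take m (xs ++ ys) → x ∈ take m xs ⊎ x ∈ take m ys
  ∈-take-++⁻ (suc m) []       p         = inj₂ p
  ∈-take-++⁻ (suc m) (_ ∷ xs) (here p)  = inj₁ (here p)
  ∈-take-++⁻ (suc m) (_ ∷ xs) (there p) with ∈-take-++⁻ m xs p
  ... | inj₁ q = inj₁ (there q)
  ... | inj₂ q = inj₂ (∈-take-suc m q)

  ∈-take-++ˡ : ∀ {x : A} m xs {ys} → m ≤ length xs → x ∈ take m (xs ++ ys) → x ∈ take m xs
  ∈-take-++ˡ (suc m) (_ ∷ xs) _         (here p)  = here p
  ∈-take-++ˡ (suc m) (_ ∷ xs) (s≤s m≤) (there p) = there (∈-take-++ˡ m xs m≤ p)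

  lookup-∈-take : ∀ m (xs : List A) i → toℕ i < m → lookup xs i ∈ take m xs
  lookup-∈-take (suc m) (_ ∷ xs) Fin.zero    _         = here refl
  lookup-∈-take (suc m) (_ ∷ xs) (Fin.suc i) (s≤s i<m) = there (lookup-∈-take m xs i i<m)

  lookup-∈-++ˡ : ∀ {xs} (ys zs : List A) → xs ≡ ys ++ zs → ∀ i → toℕ i < length ys → lookup xs i ∈ ys
  lookup-∈-++ˡ (_ ∷ ys) zs refl Fin.zero    _         = here refl
  lookup-∈-++ˡ (_ ∷ ys) zs refl (Fin.suc i) (s≤s i<) = there (lookup-∈-++ˡ ys zs refl i i<)

  lookup-∈-++ʳ : ∀ {xs} (ys zs : List A) → xs ≡ ys ++ zs → ∀ i → length ys ≤ toℕ i → lookup xs i ∈ zs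
  lookup-∈-++ʳ []       zs refl i           _         = ∈-lookup i
  lookup-∈-++ʳ (_ ∷ ys) zs refl (Fin.suc i) (s≤s ≤i) = lookup-∈-++ʳ ys zs refl i ≤i

  lookup-injective : ∀ {xs : List A} → Unique xs → Injective _≡_ _≡_ (lookup xs)
  lookup-injective (_  ∷ _) {Fin.zero}  {Fin.zero}  _ = refl
  lookup-injective (x∉ ∷ _) {Fin.zero}  {Fin.suc j} e = ⊥-elim (All.lookup x∉ (∈-lookup j) e)
  lookup-injective (x∉ ∷ _) {Fin.suc i} {Fin.zero}  e = ⊥-elim (All.lookup x∉ (∈-lookup i) (sym e))
  lookup-injective (_  ∷ u) {Fin.suc i} {Fin.suc j} e = cong Fin.suc (lookup-injective u e)

  Unique-⊆⇒length≤ : ∀ {xs ys : List A} → Unique xs → xs ⊆ ys → length xs ≤ length ys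
  Unique-⊆⇒length≤ {xs} {ys} u xs⊆ys = Finₚ.injective⇒≤ injective
    where
    position : Fin (length xs) → Fin (length ys)
    position i = index (xs⊆ys (∈-lookup i))
    injective : Injective _≡_ _≡_ position
    injective {i} {j} e = lookup-injective u (begin
      lookup xs i            ≡⟨ lookup-index (xs⊆ys (∈-lookup i)) ⟩
      lookup ys (position i) ≡⟨ cong (lookup ys) e ⟩
      lookup ys (position j) ≡⟨ lookup-index (xs⊆ys (∈-lookup j)) ⟨
      lookup xs j            ∎)
      where open ≡-Reasoning

  Linked-∷-applyUpTo-++ : ∀ {R : A → A → Set} {x ys} g m → R x (g 0) →
    (∀ {i} → i < m → R (g i) (g (suc i))) → Linked R (g m ∷ ys) →
    Linked R (x ∷ applyUpTo g (suc m) ++ ys)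
  Linked-∷-applyUpTo-++ g zero    x→g₀ _     rest = x→g₀ ∷ rest
  Linked-∷-applyUpTo-++ g (suc m) x→g₀ steps rest =
    x→g₀ ∷ Linked-∷-applyUpTo-++ (g ∘ suc) m (steps (s≤s z≤n)) (steps ∘ s≤s) rest

module _ {A B : Set} where

  open import Data.List.Membership.Propositional using (_∈_)

  Unique-map⁺-on : ∀ {P : A → Set} {f : A → B} →
    (∀ {x y} → P x → P y → f x ≡ f y → x ≡ y) →
    ∀ {xs} → All P xs → Unique xs → Unique (map f xs)
  Unique-map⁺-on f-inj {[]}    []         []        = []
  Unique-map⁺-on f-inj {_ ∷ _} (px ∷ pxs) (x∉ ∷ u) =
    Allₚ.map⁺ (All.zipWith (λ (py , x≢y) e → x≢y (f-inj px py e)) (pxs , x∉))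
      ∷ Unique-map⁺-on f-inj pxs u

  Unique-concat-by-classifier : (block : B → List A) (classify : A → B) →
    ∀ {ts} → Unique ts → All (Unique ∘ block) ts →
    All (λ t → ∀ {x} → x ∈ block t → classify x ≡ t) ts →
    Unique (concat (map block ts))
  Unique-concat-by-classifier block classify {[]}    _          _        _        = []
  Unique-concat-by-classifier block classify {t ∷ ts} (t∉ ∷ u) (ub ∷ ubs) (c ∷ cs) =
    Uniqueₚ.++⁺ ub (Unique-concat-by-classifier block classify u ubs cs) disjoint
    where
    disjoint : Disjoint (block t) (concat (map block ts))
    disjoint (x∈t , x∈ts) with ∈-concat⁻′ (map block ts) x∈ts
    ... | _ , x∈t' , t'∈ with ∈-map⁻ block t'∈
    ... | t' , t'∈ts , refl =
      All.lookup t∉ t'∈ts (trans (sym (c x∈t)) (All.lookup cs t'∈ts x∈t'))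

-- k-th powers of paths along lists

module PathPowers {A : Set} (_↝_ : A → A → Set) (k : ℕ) where

  open import Data.List.Membership.Propositional using (_∈_)

  PathPower : List A → Set
  PathPower []       = ⊤
  PathPower (x ∷ xs) = (∀ {y} → y ∈ take k xs → x ↝ y) × PathPower xs

  BeatsPrefix : List A → List A → Set
  BeatsPrefix xs ys = ∀ {x y} → x ∈ xs → y ∈ take k ys → x ↝ y

  AllPairs⇒PathPower : ∀ {xs} → AllPairs _↝_ xs → PathPower xs
  AllPairs⇒PathPower {[]}     []         = tt
  AllPairs⇒PathPower {_ ∷ xs} (x↝ ∷ ps) = (λ y∈ → All.lookup x↝ (∈-take k y∈)) , AllPairs⇒PathPower ps

  PathPower-++ : ∀ {xs ys} → PathPower xs → PathPower ys → BeatsPrefix xs ys → PathPower (xs ++ ys)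
  PathPower-++ {[]}     _          pys _    = pys
  PathPower-++ {x ∷ xs} {ys} (x↝ , pxs) pys x▷y = x↝xs++ys , PathPower-++ pxs pys (x▷y ∘ there)
    where
    x↝xs++ys : ∀ {y} → y ∈ take k (xs ++ ys) → x ↝ y
    x↝xs++ys y∈ with ∈-take-++⁻ k xs y∈
    ... | inj₁ y∈xs = x↝ y∈xs
    ... | inj₂ y∈ys = x▷y (here refl) y∈ys

  PathPower-concat : ∀ {xss} → All PathPower xss → All (λ xs → k ≤ length xs) xss →
    Linked BeatsPrefix xss → PathPower (concat xss)
  PathPower-concat {[]}     _          _        _ = tt
  PathPower-concat {xs ∷ []} (p ∷ []) _        _ = PathPower-++ p tt (λ _ y∈ → contradiction (∈-take k y∈) λ ())
  PathPower-concat {xs ∷ ys ∷ xss} (p ∷ ps) (_ ∷ k≤ ∷ k≤s) (xs▷ys ∷ linked) =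
    PathPower-++ p (PathPower-concat ps (k≤ ∷ k≤s) linked)
      (λ x∈ y∈ → xs▷ys x∈ (∈-take-++ˡ k ys k≤ y∈))

  PathPower-lookup : ∀ {xs} → PathPower xs → ∀ i j → toℕ i < toℕ j → toℕ j ≤ toℕ i + k →
    lookup xs i ↝ lookup xs j
  PathPower-lookup {_ ∷ xs} (x↝ , _) Fin.zero (Fin.suc j) _ j≤k = x↝ (lookup-∈-take k xs j j≤k)
  PathPower-lookup {_ ∷ xs} (_ , p) (Fin.suc i) (Fin.suc j) (s≤s i<j) (s≤s j≤) =
    PathPower-lookup p i j i<j j≤

module _ {A B : Set} {_↝_ : B → B → Set} {f : A → B} (k : ℕ) where
  open import Data.List.Membership.Propositional using (_∈_)

  open PathPowers using (PathPower)

  PathPower-map⁺ : ∀ {xs} → PathPower (λ x y → f x ↝ f y) k xs → PathPower _↝_ k (map f xs)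
  PathPower-map⁺ {[]}     _          = tt
  PathPower-map⁺ {x ∷ xs} (x↝ , pxs) = fx↝ , PathPower-map⁺ pxs
    where
    fx↝ : ∀ {y} → y ∈ take k (map f xs) → f x ↝ y
    fx↝ y∈ rewrite take-map {f = f} k xs with ∈-map⁻ f y∈
    ... | _ , z∈ , refl = x↝ z∈

-- Hamilton paths from duplicate-free lists of all vertices

module _ {n : ℕ} (T : Tournament n) (k : ℕ) where
  open PathPowers (_⟶_ T) k

  open import Data.List.Membership.Propositional using (_∈_)

  module FromList (L : List (Fin n)) (unique : Unique L) (complete : ∀ v → v ∈ L) where

    length≡n : length L ≡ n
    length≡n = ≤-antisym
      (subst (length L ≤_) (length-tabulate id) (Unique-⊆⇒length≤ unique (λ _ → ∈-allFin _)))
      (subst (_≤ length L) (length-tabulate id)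
        (Unique-⊆⇒length≤ (Uniqueₚ.allFin⁺ n) (λ {v} _ → complete v)))

    position : Fin n → Fin (length L)
    position = cast (sym length≡n)

    toℕ-position : ∀ i → toℕ (position i) ≡ toℕ i
    toℕ-position = Finₚ.toℕ-cast (sym length≡n)

    path : Fin n → Fin n
    path = lookup L ∘ position

    path-injective : Injective _≡_ _≡_ path
    path-injective {i} {j} e = Finₚ.toℕ-injective (begin
      toℕ i            ≡⟨ toℕ-position i ⟨
      toℕ (position i) ≡⟨ cong toℕ (lookup-injective unique e) ⟩
      toℕ (position j) ≡⟨ toℕ-position j ⟩
      toℕ j            ∎)
      where open ≡-Reasoning

    path-surjective : Surjective _≡_ _≡_ path
    path-surjective v = cast length≡n (index (complete v)) , λ { refl →
      trans (cong (lookup L) (Finₚ.cast-involutive (sym length≡n) length≡n _))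
            (sym (lookup-index (complete v))) }

    path-edges : PathPower L → ∀ i j → toℕ i < toℕ j → toℕ j ≤ toℕ i + k → _⟶_ T (path i) (path j)
    path-edges p i j i<j j≤i+k = PathPower-lookup p (position i) (position j)
      (subst₂ _<_ (sym (toℕ-position i)) (sym (toℕ-position j)) i<j)
      (subst₂ (λ a b → a ≤ b + k) (sym (toℕ-position j)) (sym (toℕ-position i)) j≤i+k)

    path-prefix : ∀ Ps {Ms} → L ≡ Ps ++ Ms → ∀ i → toℕ i < length Ps → path i ∈ Ps
    path-prefix Ps eq i i< = lookup-∈-++ˡ Ps _ eq (position i) (subst (_< length Ps) (sym (toℕ-position i)) i<)

    path-suffix : ∀ {Ms} Qs → L ≡ Ms ++ Qs → ∀ i → n ≤ toℕ i + length Qs → path i ∈ Qs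
    path-suffix {Ms} Qs eq i n≤ = lookup-∈-++ʳ Ms Qs eq (position i)
      (subst (length Ms ≤_) (sym (toℕ-position i)) (+-cancelʳ-≤ (length Qs) (length Ms) (toℕ i) (begin
        length Ms + length Qs ≡⟨ length-++ Ms ⟨
        length (Ms ++ Qs)     ≡⟨ cong length eq ⟨
        length L              ≡⟨ length≡n ⟩
        n                     ≤⟨ n≤ ⟩
        toℕ i + length Qs     ∎)))
      where open ≤-Reasoning

module _ {n : ℕ} (T : Tournament n) where

  open import Data.Fin.Subset using () renaming (_∈_ to _∈ₛ_)

  record Enumeration (m : ℕ) (A : Subset n) : Set where
    field
      at        : Fin m → Fin n
      injective : Injective _≡_ _≡_ at
      at∈       : ∀ a → at a ∈ₛ A
      onto      : ∀ {v} → v ∈ₛ A → ∃ λ a → at a ≡ v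
      ordered   : ∀ {a b} → toℕ a < toℕ b → _⟶_ T (at a) (at b)

  enumeration : ∀ {A m} → ∣ A ∣ ≡ m → InducesTransitive T A → Enumeration m A
  enumeration eq (e , e-injective , e∈ , e-onto , e-ordered) = record
    { at        = e ∘ cast (sym eq)
    ; injective = λ {a} {b} ea≡eb → Finₚ.toℕ-injective (begin
        toℕ a                  ≡⟨ Finₚ.toℕ-cast (sym eq) a ⟨
        toℕ (cast (sym eq) a)  ≡⟨ cong toℕ (e-injective ea≡eb) ⟩
        toℕ (cast (sym eq) b)  ≡⟨ Finₚ.toℕ-cast (sym eq) b ⟩
        toℕ b                  ∎)
    ; at∈       = λ _ → e∈ _
    ; onto      = λ {v} v∈ → let (a , ea≡v) = e-onto v v∈ in
        cast eq a , trans (cong e (Finₚ.cast-involutive (sym eq) eq a)) ea≡v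
    ; ordered   = λ {a} {b} a<b → e-ordered _ _
        (subst₂ _<_ (sym (Finₚ.toℕ-cast (sym eq) a)) (sym (Finₚ.toℕ-cast (sym eq) b)) a<b)
    }
    where open ≡-Reasoning

-- The path through an absorber

module AbsorberPath (k n : ℕ) (H : Tournament n) (Ab : Absorber H k)
  (X Y : Subset n) (X⊆Q : image H (Absorber.q Ab) X) (Y⊆Q : image H (Absorber.q Ab) Y)
  (∣X∣≡2k : ∣ X ∣ ≡ 2 * k) (∣Y∣≡2k : ∣ Y ∣ ≡ 2 * k)
  (X-transitive : InducesTransitive H X) (Y-transitive : InducesTransitive H Y) where

  open import Data.List.Membership.Propositional using (_∈_; _∉_)
  open import Data.Fin.Subset using () renaming (_∈_ to _∈ₛ_)

  open Absorber Ab
  open Enumeration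

  _↦_ : Fin n → Fin n → Set
  u ↦ v = _⟶_ H u v

  R : ℕ
  R = 2 ^ (10 * k)

  2k≡k+k : 2 * k ≡ k + k
  2k≡k+k = cong (k +_) (+-identityʳ k)

  enumS : ∀ i → i ≤ r → Enumeration H (k + k) (S i)
  enumS i i≤r = enumeration H (trans (S-size i i≤r) 2k≡k+k) (S-trans i i≤r)

  -- inj₁ (i , a) codes the a-th vertex of S i in its transitive order.
  Code : Set
  Code = (ℕ × Fin (k + k)) ⊎ Fin R

  -- codes (i , a) with r < i never occur; they are sent to an arbitrary vertex
  vertexOfS : ∀ i → Fin (k + k) → Dec (i ≤ r) → Fin n
  vertexOfS i a (yes i≤r) = at (enumS i i≤r) a
  vertexOfS i a (no _)    = at (enumS 0 z≤n) a

  vertex : Code → Fin n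
  vertex (inj₁ (i , a)) = vertexOfS i a (i ≤? r)
  vertex (inj₂ j)       = q j

  _↝_ : Code → Code → Set
  c ↝ d = vertex c ↦ vertex d

  Valid : Code → Set
  Valid (inj₁ (i , _)) = i ≤ r
  Valid (inj₂ _)       = ⊤

  vertex-inj₁ : ∀ {i a} (i≤r : i ≤ r) → vertex (inj₁ (i , a)) ≡ at (enumS i i≤r) a
  vertex-inj₁ {i} {a} i≤r with i ≤? r
  ... | yes i≤r′ = cong (λ p → at (enumS i p) a) (≤-irrelevant i≤r′ i≤r)
  ... | no  i≰r  = contradiction i≤r i≰r

  vertex∈S : ∀ {i a} → i ≤ r → vertex (inj₁ (i , a)) ∈ₛ S i
  vertex∈S i≤r = subst (_∈ₛ S _) (sym (vertex-inj₁ i≤r)) (at∈ (enumS _ i≤r) _)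

  vertex-ordered : ∀ {i a b} → i ≤ r → toℕ a < toℕ b → inj₁ (i , a) ↝ inj₁ (i , b)
  vertex-ordered i≤r a<b =
    subst₂ _↦_ (sym (vertex-inj₁ i≤r)) (sym (vertex-inj₁ i≤r)) (ordered (enumS _ i≤r) a<b)

  vertex-injective : ∀ {c d} → Valid c → Valid d → vertex c ≡ vertex d → c ≡ d
  vertex-injective {inj₁ (i , a)} {inj₁ (j , b)} i≤r j≤r e
    with refl ← S-disj i j _ i≤r j≤r (vertex∈S i≤r) (subst (_∈ₛ S j) (sym e) (vertex∈S j≤r)) =
    cong (λ a → inj₁ (i , a))
      (injective (enumS i i≤r) (trans (sym (vertex-inj₁ i≤r)) (trans e (vertex-inj₁ i≤r))))
  vertex-injective {inj₁ (i , a)} {inj₂ j} i≤r _ e =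
    contradiction (subst (_∈ₛ S i) e (vertex∈S i≤r)) (SQ-disj i j i≤r)
  vertex-injective {inj₂ j} {inj₁ (i , a)} _ i≤r e =
    contradiction (subst (_∈ₛ S i) (sym e) (vertex∈S i≤r)) (SQ-disj i j i≤r)
  vertex-injective {inj₂ i} {inj₂ j} _ _ e = cong inj₂ (q-inj e)

  vertex-onto : ∀ v → ∃ λ c → Valid c × vertex c ≡ v
  vertex-onto v with cover v
  ... | inj₁ (i , i≤r , v∈Sᵢ) = let (a , eq) = onto (enumS i i≤r) v∈Sᵢ in
                                inj₁ (i , a) , i≤r , trans (vertex-inj₁ i≤r) eq
  ... | inj₂ (j , eq)         = inj₂ j , tt , eq

  module QIndices {A : Subset n} (A⊆Q : image H q A) (e : Enumeration H (k + k) A) where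

    qIndex : Fin (k + k) → Fin R
    qIndex a = proj₁ (A⊆Q (at e a) (at∈ e a))

    q-qIndex : ∀ a → q (qIndex a) ≡ at e a
    q-qIndex a = proj₂ (A⊆Q (at e a) (at∈ e a))

    q-qIndex∈ : ∀ a → q (qIndex a) ∈ₛ A
    q-qIndex∈ a = subst (_∈ₛ A) (sym (q-qIndex a)) (at∈ e a)

    qIndex-injective : Injective _≡_ _≡_ qIndex
    qIndex-injective {a} {b} eq =
      injective e (trans (sym (q-qIndex a)) (trans (cong q eq) (q-qIndex b)))

    qIndex-ordered : ∀ {a b} → toℕ a < toℕ b → q (qIndex a) ↦ q (qIndex b)
    qIndex-ordered a<b = subst₂ _↦_ (sym (q-qIndex _)) (sym (q-qIndex _)) (ordered e a<b)

  module QX = QIndices X⊆Q (enumeration H (trans ∣X∣≡2k 2k≡k+k) X-transitive)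
  module QY = QIndices Y⊆Q (enumeration H (trans ∣Y∣≡2k 2k≡k+k) Y-transitive)

  open DecMembership (Finₚ._≟_ {R}) using (_∈?_)

  Y₀ : List (Fin R)
  Y₀ = tabulate (λ a → QY.qIndex (a ↑ˡ k))

  X-Y₀ : List (Fin R)
  X-Y₀ = filter (λ j → ¬? (j ∈? Y₀)) (tabulate QX.qIndex)

  X₀ : List (Fin R)
  X₀ = take k X-Y₀

  length-Y₀ : length Y₀ ≡ k
  length-Y₀ = length-tabulate _

  -- Y₀ removes at most k of the 2k indices of X.
  length-X₀ : length X₀ ≡ k
  length-X₀ = trans (length-take k X-Y₀) (m≤n⇒m⊓n≡m k≤length)
    where
    X⊆X-Y₀++Y₀ : ∀ {j} → j ∈ tabulate QX.qIndex → j ∈ X-Y₀ ++ Y₀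
    X⊆X-Y₀++Y₀ {j} j∈ with j ∈? Y₀
    ... | yes j∈Y₀ = ∈-++⁺ʳ X-Y₀ j∈Y₀
    ... | no  j∉Y₀ = ∈-++⁺ˡ (∈-filter⁺ (λ j → ¬? (j ∈? Y₀)) j∈ j∉Y₀)
    k≤length : k ≤ length X-Y₀
    k≤length = +-cancelʳ-≤ k k (length X-Y₀) (begin
      k + k                      ≡⟨ length-tabulate QX.qIndex ⟨
      length (tabulate QX.qIndex) ≤⟨ Unique-⊆⇒length≤ (Uniqueₚ.tabulate⁺ QX.qIndex-injective) X⊆X-Y₀++Y₀ ⟩
      length (X-Y₀ ++ Y₀)        ≡⟨ trans (length-++ X-Y₀) (cong (length X-Y₀ +_) length-Y₀) ⟩
      length X-Y₀ + k            ∎)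
      where open ≤-Reasoning

  X₀⊆X-Y₀ : ∀ {j} → j ∈ X₀ → j ∈ tabulate QX.qIndex × j ∉ Y₀
  X₀⊆X-Y₀ j∈ = ∈-filter⁻ (λ j → ¬? (j ∈? Y₀)) (∈-take k j∈)

  Free : Fin R → Set
  Free j = j ∉ Y₀ × j ∉ X₀

  free? : ∀ j → Dec (Free j)
  free? j = ¬? (j ∈? Y₀) ×-dec ¬? (j ∈? X₀)

  lowerHalf upperHalf : ℕ → List Code
  lowerHalf i = tabulate (λ a → inj₁ (i , a ↑ˡ k))
  upperHalf i = tabulate (λ a → inj₁ (i , k ↑ʳ a))

  absorbedIfFree : ∀ {j} → Dec (Free j) → List Code
  absorbedIfFree {j} (yes _) = inj₂ j ∷ []
  absorbedIfFree     (no _)  = []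

  firstLapRest : ∀ t → Dec (t < R) → List Code
  firstLapRest t (yes t<R) = upperHalf (suc t) ++ absorbedIfFree (free? (fromℕ< t<R))
  firstLapRest t (no _)    = []

  firstLapTail : ℕ → List Code
  firstLapTail zero    = []
  firstLapTail (suc t) = firstLapRest t (t <? R)

  data Part : Set where
    initial final       : Part
    firstLap secondLap : ℕ → Part

  block : Part → List Code
  block initial       = map inj₂ Y₀
  block (firstLap i)  = lowerHalf i ++ firstLapTail i
  block (secondLap i) = upperHalf i
  block final         = map inj₂ X₀

  ∈-absorbedIfFree⁻ : ∀ {j c} (d : Dec (Free j)) → c ∈ absorbedIfFree d → c ≡ inj₂ j × Free j
  ∈-absorbedIfFree⁻ (yes free) (here refl) = refl , free

  data InFirstLapTail (i : ℕ) : Code → Set where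
    upper    : ∀ {t} a → i ≡ suc t → t < R → InFirstLapTail i (inj₁ (i , k ↑ʳ a))
    absorbed : ∀ j → suc (toℕ j) ≡ i → Free j → InFirstLapTail i (inj₂ j)

  ∈-firstLapTail⁻ : ∀ i {c} → c ∈ firstLapTail i → InFirstLapTail i c
  ∈-firstLapTail⁻ (suc t) c∈ = ∈-rest⁻ (t <? R) c∈
    where
    ∈-rest⁻ : ∀ {c} (d : Dec (t < R)) → c ∈ firstLapRest t d → InFirstLapTail (suc t) c
    ∈-rest⁻ (yes t<R) c∈ with ∈-++⁻ (upperHalf (suc t)) c∈
    ... | inj₁ c∈upper with ∈-tabulate⁻ c∈upper
    ...   | a , refl = upper a refl t<R
    ∈-rest⁻ (yes t<R) c∈ | inj₂ c∈absorbed with ∈-absorbedIfFree⁻ _ c∈absorbed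
    ...   | refl , free = absorbed _ (cong suc (Finₚ.toℕ-fromℕ< t<R)) free

  half : ℕ → Fin k ⊎ Fin k → Part
  half i (inj₁ _) = firstLap i
  half i (inj₂ _) = secondLap i

  partOfS : ∀ t → Fin (k + k) → Dec (t < R) → Part
  partOfS t a (yes _) = firstLap (suc t)
  partOfS t a (no _)  = half (suc t) (splitAt k a)

  partOfQ : ∀ j → Dec (j ∈ Y₀) → Dec (j ∈ X₀) → Part
  partOfQ j (yes _) _       = initial
  partOfQ j (no _)  (yes _) = final
  partOfQ j (no _)  (no _)  = firstLap (suc (toℕ j))

  partOf : Code → Part
  partOf (inj₁ (zero , a))  = half zero (splitAt k a)
  partOf (inj₁ (suc t , a)) = partOfS t a (t <? R)
  partOf (inj₂ j)           = partOfQ j (j ∈? Y₀) (j ∈? X₀)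

  Admissible : Part → Set
  Admissible (firstLap i)  = i ≤ r
  Admissible (secondLap i) = i ≤ r × (i ≡ 0 ⊎ R < i)
  Admissible _             = ⊤

  partOf-lower : ∀ i a → partOf (inj₁ (i , a ↑ˡ k)) ≡ firstLap i
  partOf-lower zero a rewrite Finₚ.splitAt-↑ˡ k a k = refl
  partOf-lower (suc t) a with t <? R
  ... | yes _ = refl
  ... | no  _ rewrite Finₚ.splitAt-↑ˡ k a k = refl

  partOf-upper : ∀ i a → i ≡ 0 ⊎ R < i → partOf (inj₁ (i , k ↑ʳ a)) ≡ secondLap i
  partOf-upper zero    a _ rewrite Finₚ.splitAt-↑ʳ k k a = refl
  partOf-upper (suc t) a (inj₂ R<1+t) with t <? R
  ... | yes t<R = contradiction t<R (≤⇒≯ (s≤s⁻¹ R<1+t))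
  ... | no  _   rewrite Finₚ.splitAt-↑ʳ k k a = refl

  partOf-firstLapTail : ∀ {i c} → InFirstLapTail i c → partOf c ≡ firstLap i
  partOf-firstLapTail (upper {t} a refl t<R) with t <? R
  ... | yes _   = refl
  ... | no  t≮R = contradiction t<R t≮R
  partOf-firstLapTail (absorbed j refl (j∉Y₀ , j∉X₀)) with j ∈? Y₀ | j ∈? X₀
  ... | yes j∈Y₀ | _        = contradiction j∈Y₀ j∉Y₀
  ... | no  _    | yes j∈X₀ = contradiction j∈X₀ j∉X₀
  ... | no  _    | no  _    = refl

  partOf-block : ∀ t → Admissible t → ∀ {c} → c ∈ block t → partOf c ≡ t
  partOf-block initial _ c∈ with ∈-map⁻ inj₂ c∈
  ... | j , j∈Y₀ , refl with j ∈? Y₀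
  ...   | yes _    = refl
  ...   | no  j∉Y₀ = contradiction j∈Y₀ j∉Y₀
  partOf-block final _ c∈ with ∈-map⁻ inj₂ c∈
  ... | j , j∈X₀ , refl with j ∈? Y₀ | j ∈? X₀
  ...   | yes j∈Y₀ | _        = contradiction j∈Y₀ (proj₂ (X₀⊆X-Y₀ j∈X₀))
  ...   | no  _    | yes _    = refl
  ...   | no  _    | no  j∉X₀ = contradiction j∈X₀ j∉X₀
  partOf-block (firstLap i) _ c∈ with ∈-++⁻ (lowerHalf i) c∈
  ... | inj₂ c∈tail = partOf-firstLapTail (∈-firstLapTail⁻ i c∈tail)
  ... | inj₁ c∈lower with ∈-tabulate⁻ c∈lower
  ...   | a , refl = partOf-lower i a
  partOf-block (secondLap i) (_ , outside) c∈ with ∈-tabulate⁻ c∈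
  ... | a , refl = partOf-upper i a outside

  valid-block : ∀ t → Admissible t → ∀ {c} → c ∈ block t → Valid c
  valid-block initial _ c∈ with ∈-map⁻ inj₂ c∈
  ... | _ , _ , refl = tt
  valid-block final _ c∈ with ∈-map⁻ inj₂ c∈
  ... | _ , _ , refl = tt
  valid-block (firstLap i) i≤r c∈ with ∈-++⁻ (lowerHalf i) c∈
  ... | inj₁ c∈lower with ∈-tabulate⁻ c∈lower
  ...   | _ , refl = i≤r
  valid-block (firstLap i) i≤r c∈ | inj₂ c∈tail with ∈-firstLapTail⁻ i c∈tail
  ...   | upper _ _ _      = i≤r
  ...   | absorbed _ _ _   = tt
  valid-block (secondLap i) (i≤r , _) c∈ with ∈-tabulate⁻ c∈
  ... | _ , refl = i≤r

  halfOrdered : ∀ {i m} (f : Fin m → Fin (k + k)) → (∀ {a b} → toℕ a < toℕ b → toℕ (f a) < toℕ (f b)) →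
    i ≤ r → AllPairs _↝_ (tabulate (λ a → inj₁ (i , f a)))
  halfOrdered f f-mono i≤r = AllPairsₚ.tabulate⁺-< (vertex-ordered i≤r ∘ f-mono)

  lower<upper : ∀ (a b : Fin k) → toℕ (a ↑ˡ k) < toℕ (k ↑ʳ b)
  lower<upper a b = begin-strict
    toℕ (a ↑ˡ k) ≡⟨ Finₚ.toℕ-↑ˡ a k ⟩
    toℕ a        <⟨ Finₚ.toℕ<n a ⟩
    k            ≤⟨ m≤m+n k (toℕ b) ⟩
    k + toℕ b    ≡⟨ Finₚ.toℕ-↑ʳ k b ⟨
    toℕ (k ↑ʳ b) ∎
    where open ≤-Reasoning

  S↝absorbed : ∀ {i a j} → i ≤ r → suc (toℕ j) ≡ i → inj₁ (i , a) ↝ inj₂ j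
  S↝absorbed {j = j} i≤r refl = proj₂ (Sᵢ⇒qᵢ j) _ _ (vertex∈S i≤r) (x∈⁅x⁆ (q j))

  lowerHalf-ordered : ∀ {i} → i ≤ r → AllPairs _↝_ (lowerHalf i)
  lowerHalf-ordered = halfOrdered (_↑ˡ k)
    (λ {a} {b} a<b → subst₂ _<_ (sym (Finₚ.toℕ-↑ˡ a k)) (sym (Finₚ.toℕ-↑ˡ b k)) a<b)

  upperHalf-ordered : ∀ {i} → i ≤ r → AllPairs _↝_ (upperHalf i)
  upperHalf-ordered = halfOrdered (k ↑ʳ_)
    (λ {a} {b} a<b → subst₂ _<_ (sym (Finₚ.toℕ-↑ʳ k a)) (sym (Finₚ.toℕ-↑ʳ k b)) (+-monoʳ-< k a<b))

  firstLapTail-ordered : ∀ {i} → i ≤ r → AllPairs _↝_ (firstLapTail i)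
  firstLapTail-ordered {zero}  _   = []
  firstLapTail-ordered {suc t} i≤r = restOrdered (t <? R)
    where
    absorbedOrdered : ∀ {j} (d : Dec (Free j)) → AllPairs _↝_ (absorbedIfFree d)
    absorbedOrdered (yes _) = [] ∷ []
    absorbedOrdered (no _)  = []
    restOrdered : ∀ d → AllPairs _↝_ (firstLapRest t d)
    restOrdered (no _)    = []
    restOrdered (yes t<R) = AllPairsₚ.++⁺ (upperHalf-ordered i≤r) (absorbedOrdered _)
      (All.tabulate λ c∈ → All.tabulate λ d∈ → upper↝absorbed c∈ (proj₁ (∈-absorbedIfFree⁻ _ d∈)))
      where
      upper↝absorbed : ∀ {c d} → c ∈ upperHalf (suc t) → d ≡ inj₂ (fromℕ< t<R) → c ↝ d
      upper↝absorbed c∈ refl with ∈-tabulate⁻ c∈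
      ... | _ , refl = S↝absorbed i≤r (cong suc (Finₚ.toℕ-fromℕ< t<R))

  block-ordered : ∀ t → Admissible t → AllPairs _↝_ (block t)
  block-ordered initial _ = AllPairsₚ.map⁺ (AllPairsₚ.tabulate⁺-< (λ {a} {b} a<b → QY.qIndex-ordered
    (subst₂ _<_ (sym (Finₚ.toℕ-↑ˡ a k)) (sym (Finₚ.toℕ-↑ˡ b k)) a<b)))
  block-ordered final _ = AllPairsₚ.map⁺ (AllPairsₚ.take⁺ k (AllPairsₚ.filter⁺ _
    (AllPairsₚ.tabulate⁺-< QX.qIndex-ordered)))
  block-ordered (secondLap i) (i≤r , _) = upperHalf-ordered i≤r
  block-ordered (firstLap i) i≤r = AllPairsₚ.++⁺ (lowerHalf-ordered i≤r) (firstLapTail-ordered i≤r)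
    (All.tabulate λ c∈ → All.tabulate λ d∈ → lower↝tail c∈ (∈-firstLapTail⁻ i d∈))
    where
    lower↝tail : ∀ {c d} → c ∈ lowerHalf i → InFirstLapTail i d → c ↝ d
    lower↝tail c∈ d∈ with ∈-tabulate⁻ c∈
    lower↝tail c∈ (upper b _ _)    | a , refl = vertex-ordered i≤r (lower<upper a b)
    lower↝tail c∈ (absorbed _ eq _) | a , refl = S↝absorbed i≤r eq

  length-lowerHalf : ∀ i → length (lowerHalf i) ≡ k
  length-lowerHalf i = length-tabulate _

  k≤length-block : ∀ t → k ≤ length (block t)
  k≤length-block initial       = ≤-reflexive (sym (trans (length-map inj₂ Y₀) length-Y₀))
  k≤length-block final         = ≤-reflexive (sym (trans (length-map inj₂ X₀) length-X₀))
  k≤length-block (secondLap i) = ≤-reflexive (sym (length-tabulate _))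
  k≤length-block (firstLap i)  =
    subst (_≤ length (block (firstLap i))) (length-lowerHalf i) (length-++-≤ˡ (lowerHalf i))

  open PathPowers _↝_ k

  data OnCycle (i : ℕ) : Part → Set where
    onFirstLap  : OnCycle i (firstLap i)
    onSecondLap : OnCycle i (secondLap i)

  leader∈S : ∀ {i t c} → i ≤ r → OnCycle i t → c ∈ take k (block t) → vertex c ∈ₛ S i
  leader∈S {i} i≤r onFirstLap c∈
    with ∈-tabulate⁻ (∈-take k (∈-take-++ˡ k (lowerHalf i) (≤-reflexive (sym (length-lowerHalf i))) c∈))
  ... | _ , refl = vertex∈S i≤r
  leader∈S i≤r onSecondLap c∈ with ∈-tabulate⁻ (∈-take k c∈)
  ... | _ , refl = vertex∈S i≤r

  member∈S⊎absorbed : ∀ {i t c} → i ≤ r → OnCycle i t → c ∈ block t →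
    vertex c ∈ₛ S i ⊎ ∃ λ j → vertex c ≡ q j × suc (toℕ j) ≡ i
  member∈S⊎absorbed {i} i≤r onFirstLap c∈ with ∈-++⁻ (lowerHalf i) c∈
  ... | inj₁ c∈lower with ∈-tabulate⁻ c∈lower
  ...   | _ , refl = inj₁ (vertex∈S i≤r)
  member∈S⊎absorbed {i} i≤r onFirstLap c∈ | inj₂ c∈tail with ∈-firstLapTail⁻ i c∈tail
  ...   | upper _ _ _     = inj₁ (vertex∈S i≤r)
  ...   | absorbed j eq _ = inj₂ (j , refl , eq)
  member∈S⊎absorbed i≤r onSecondLap c∈ with ∈-tabulate⁻ c∈
  ... | _ , refl = inj₁ (vertex∈S i≤r)

  cycleStep : ∀ {i j t t′} → i ≤ r → j ≤ r →
    (∀ {u v} → u ∈ₛ S i → v ∈ₛ S j → u ↦ v) →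
    (∀ {p v} → suc (toℕ p) ≡ i → v ∈ₛ S j → q p ↦ v) →
    OnCycle i t → OnCycle j t′ → BeatsPrefix (block t) (block t′)
  cycleStep i≤r j≤r S⇒S q⇒S on on′ c∈ d∈ with member∈S⊎absorbed i≤r on c∈
  ... | inj₁ c∈S            = S⇒S c∈S (leader∈S j≤r on′ d∈)
  ... | inj₂ (p , eq , p≡) = subst (_↦ _) (sym eq) (q⇒S p≡ (leader∈S j≤r on′ d∈))

  successorStep : ∀ {i t t′} → i < r → OnCycle i t → OnCycle (suc i) t′ → BeatsPrefix (block t) (block t′)
  successorStep {i} i<r = cycleStep (<⇒≤ i<r) i<r
    (λ u∈ v∈ → proj₂ (S-chain i i<r) _ _ u∈ v∈)
    (λ {p} {v} p≡ v∈ → proj₂ (qᵢ⇒Sᵢ₊₁ p) _ _ (x∈⁅x⁆ (q p)) (subst (λ i → v ∈ₛ S (suc i)) (sym p≡) v∈))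

  R<r : R < r
  R<r = r'<r

  wrapStep : ∀ {t t′} → OnCycle r t → OnCycle 0 t′ → BeatsPrefix (block t) (block t′)
  wrapStep = cycleStep ≤-refl z≤n
    (λ u∈ v∈ → proj₂ S-close _ _ u∈ v∈)
    (λ {p} p≡ _ → contradiction p≡ (<⇒≢ (≤-<-trans (Finₚ.toℕ<n p) R<r)))

  initialStep : BeatsPrefix (block initial) (block (firstLap (suc R)))
  initialStep c∈ d∈ with ∈-map⁻ inj₂ c∈
  ... | j , _ , refl = proj₂ (Q⇒S j) _ _ (x∈⁅x⁆ (q j)) (leader∈S R<r onFirstLap d∈)

  finalStep : BeatsPrefix (block (secondLap 0)) (block final)
  finalStep c∈ d∈ with ∈-tabulate⁻ c∈ | ∈-map⁻ inj₂ (∈-take k d∈)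
  ... | _ , refl | j , _ , refl = proj₂ (S₀⇒Q j) _ _ (vertex∈S z≤n) (x∈⁅x⁆ (q j))

  D : ℕ
  D = r ∸ suc R

  D+1+R≡r : D + suc R ≡ r
  D+1+R≡r = m∸n+n≡m R<r

  outer≤r : ∀ {i} → i < suc D → i + suc R ≤ r
  outer≤r {i} i<1+D = subst (i + suc R ≤_) D+1+R≡r (+-monoˡ-≤ (suc R) (s≤s⁻¹ i<1+D))

  firstLapOuter firstLapInner secondLapOuter : List Part
  firstLapOuter  = applyUpTo (firstLap ∘ (_+ suc R)) (suc D)
  firstLapInner  = applyUpTo firstLap (suc R)
  secondLapOuter = applyUpTo (secondLap ∘ (_+ suc R)) (suc D)

  middle : List Part
  middle = firstLapOuter ++ firstLapInner ++ secondLapOuter ++ secondLap 0 ∷ []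

  parts : List Part
  parts = initial ∷ firstLapOuter ++ firstLapInner ++ secondLapOuter ++ secondLap 0 ∷ final ∷ []

  parts≡ : parts ≡ (initial ∷ middle) ++ final ∷ []
  parts≡ = cong (initial ∷_) (sym (begin
    (firstLapOuter ++ firstLapInner ++ secondLapOuter ++ _) ++ _ ≡⟨ ++-assoc firstLapOuter _ _ ⟩
    firstLapOuter ++ (firstLapInner ++ secondLapOuter ++ _) ++ _ ≡⟨ cong (firstLapOuter ++_) (++-assoc firstLapInner _ _) ⟩
    firstLapOuter ++ firstLapInner ++ (secondLapOuter ++ _) ++ _ ≡⟨ cong (λ xs → firstLapOuter ++ firstLapInner ++ xs) (++-assoc secondLapOuter _ _) ⟩
    firstLapOuter ++ firstLapInner ++ secondLapOuter ++ _        ∎))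
    where open ≡-Reasoning

  Step : Part → Part → Set
  Step t t′ = BeatsPrefix (block t) (block t′)

  parts-linked : Linked Step parts
  parts-linked =
    Linked-∷-applyUpTo-++ (firstLap ∘ (_+ suc R)) D initialStep
      (λ i<D → successorStep (outer≤r (s≤s i<D)) onFirstLap onFirstLap)
      (subst (λ i → Linked Step (firstLap i ∷ firstLapInner ++ secondLapOuter ++ secondLap 0 ∷ final ∷ [])) (sym D+1+R≡r)
        (Linked-∷-applyUpTo-++ firstLap R (wrapStep onFirstLap onFirstLap)
          (λ i<R → successorStep (<-trans i<R R<r) onFirstLap onFirstLap)
          (Linked-∷-applyUpTo-++ (secondLap ∘ (_+ suc R)) D (successorStep R<r onFirstLap onSecondLap)
            (λ i<D → successorStep (outer≤r (s≤s i<D)) onSecondLap onSecondLap)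
            (subst (λ i → Linked Step (secondLap i ∷ secondLap 0 ∷ final ∷ [])) (sym D+1+R≡r)
              (wrapStep onSecondLap onSecondLap ∷ finalStep ∷ [-])))))

  parts-admissible : All Admissible parts
  parts-admissible = tt ∷ Allₚ.++⁺ (Allₚ.applyUpTo⁺₁ _ _ outer≤r)
    (Allₚ.++⁺ (Allₚ.applyUpTo⁺₁ _ _ (λ i<1+R → ≤-trans (s≤s⁻¹ i<1+R) (<⇒≤ R<r)))
      (Allₚ.++⁺ (Allₚ.applyUpTo⁺₁ _ _ (λ {i} i<1+D → outer≤r i<1+D , inj₂ (m≤n+m (suc R) i)))
        ((z≤n , inj₁ refl) ∷ tt ∷ [])))

  firstLap-injective : ∀ {i j} → firstLap i ≡ firstLap j → i ≡ j
  firstLap-injective refl = refl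

  secondLap-injective : ∀ {i j} → secondLap i ≡ secondLap j → i ≡ j
  secondLap-injective refl = refl

  outer-unique : (P : ℕ → Part) → (∀ {i j} → P i ≡ P j → i ≡ j) →
    Unique (applyUpTo (P ∘ (_+ suc R)) (suc D))
  outer-unique P P-injective = Uniqueₚ.applyUpTo⁺₁ _ _
    (λ i<j _ eq → <⇒≢ i<j (+-cancelʳ-≡ (suc R) _ _ (P-injective eq)))

  firstLap∉secondLaps : ∀ {i} → firstLap i ∉ secondLapOuter ++ secondLap 0 ∷ final ∷ []
  firstLap∉secondLaps p with ∈-++⁻ secondLapOuter p
  ... | inj₁ p′ with ∈-applyUpTo⁻ (secondLap ∘ (_+ suc R)) p′
  ...   | _ , _ , ()
  firstLap∉secondLaps p | inj₂ (here ())
  firstLap∉secondLaps p | inj₂ (there (here ()))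

  parts-unique : Unique parts
  parts-unique = initial∉ ∷ Uniqueₚ.++⁺ (outer-unique firstLap firstLap-injective)
      (Uniqueₚ.++⁺ (Uniqueₚ.applyUpTo⁺₁ _ _ (λ i<j _ → <⇒≢ i<j ∘ firstLap-injective))
        (Uniqueₚ.++⁺ (outer-unique secondLap secondLap-injective) (((λ ()) ∷ []) ∷ [] ∷ [])
          outer₂∩last)
        inner∩rest)
      outer₁∩rest
    where
    initial∉ : All (initial ≢_) (firstLapOuter ++ firstLapInner ++ secondLapOuter ++ secondLap 0 ∷ final ∷ [])
    initial∉ = Allₚ.++⁺ (Allₚ.applyUpTo⁺₂ (firstLap ∘ (_+ suc R)) (suc D) λ _ ())
      (Allₚ.++⁺ (Allₚ.applyUpTo⁺₂ firstLap (suc R) λ _ ())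
      (Allₚ.++⁺ (Allₚ.applyUpTo⁺₂ (secondLap ∘ (_+ suc R)) (suc D) λ _ ()) ((λ ()) ∷ (λ ()) ∷ [])))
    outer₂∩last : Disjoint secondLapOuter (secondLap 0 ∷ final ∷ [])
    outer₂∩last (p , here eq) with ∈-applyUpTo⁻ (secondLap ∘ (_+ suc R)) p
    ... | i , _ , refl = contradiction (trans (sym (+-suc i R)) (secondLap-injective eq)) λ ()
    outer₂∩last (p , there (here refl)) with ∈-applyUpTo⁻ (secondLap ∘ (_+ suc R)) p
    ... | _ , _ , ()
    inner∩rest : Disjoint firstLapInner (secondLapOuter ++ secondLap 0 ∷ final ∷ [])
    inner∩rest (p , p′) with ∈-applyUpTo⁻ firstLap p
    ... | _ , _ , refl = firstLap∉secondLaps p′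
    outer₁∩rest : Disjoint firstLapOuter (firstLapInner ++ secondLapOuter ++ secondLap 0 ∷ final ∷ [])
    outer₁∩rest (p , p′) with ∈-applyUpTo⁻ (firstLap ∘ (_+ suc R)) p
    ... | i , _ , refl with ∈-++⁻ firstLapInner p′
    ...   | inj₂ p″ = firstLap∉secondLaps p″
    ...   | inj₁ p″ with ∈-applyUpTo⁻ firstLap p″
    ...     | j , j<1+R , eq = <⇒≱ j<1+R (subst (suc R ≤_) (firstLap-injective eq) (m≤n+m (suc R) i))

  codes : List Code
  codes = concat (map block parts)

  ∈-codes : ∀ {t c} → t ∈ parts → c ∈ block t → c ∈ codes
  ∈-codes t∈ c∈ = ∈-concat⁺′ c∈ (∈-map⁺ block t∈)

  outer∈ : ∀ {A : Set} (P : ℕ → A) {i} → R < i → i ≤ r → P i ∈ applyUpTo (P ∘ (_+ suc R)) (suc D)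
  outer∈ P {i} R<i i≤r = subst (λ j → P j ∈ _) (m∸n+n≡m R<i)
    (∈-applyUpTo⁺ (P ∘ (_+ suc R)) (s≤s (∸-monoˡ-≤ (suc R) i≤r)))

  firstLap∈parts : ∀ {i} → i ≤ r → firstLap i ∈ parts
  firstLap∈parts {i} i≤r with R <? i
  ... | yes R<i = there (∈-++⁺ˡ (outer∈ firstLap R<i i≤r))
  ... | no  R≮i = there (∈-++⁺ʳ firstLapOuter (∈-++⁺ˡ (∈-applyUpTo⁺ firstLap (s≤s (≮⇒≥ R≮i)))))

  secondLap∈parts : ∀ {i} → R < i → i ≤ r → secondLap i ∈ parts
  secondLap∈parts R<i i≤r =
    there (∈-++⁺ʳ firstLapOuter (∈-++⁺ʳ firstLapInner (∈-++⁺ˡ (outer∈ secondLap R<i i≤r))))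

  secondLap0∈parts : secondLap 0 ∈ parts
  secondLap0∈parts = there (∈-++⁺ʳ firstLapOuter (∈-++⁺ʳ firstLapInner (∈-++⁺ʳ secondLapOuter (here refl))))

  final∈parts : final ∈ parts
  final∈parts =
    there (∈-++⁺ʳ firstLapOuter (∈-++⁺ʳ firstLapInner (∈-++⁺ʳ secondLapOuter (there (here refl)))))

  upper∈codes : ∀ i b → i ≤ r → inj₁ (i , k ↑ʳ b) ∈ codes
  upper∈codes zero    b _   = ∈-codes secondLap0∈parts (∈-tabulate⁺ b)
  upper∈codes (suc t) b i≤r with t <? R
  ... | no  t≮R = ∈-codes (secondLap∈parts (s≤s (≮⇒≥ t≮R)) i≤r) (∈-tabulate⁺ b)
  ... | yes t<R = ∈-codes (firstLap∈parts i≤r) (∈-++⁺ʳ (lowerHalf (suc t)) (∈-rest (t <? R)))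
    where
    ∈-rest : ∀ d → inj₁ (suc t , k ↑ʳ b) ∈ firstLapRest t d
    ∈-rest (yes _)  = ∈-++⁺ˡ (∈-tabulate⁺ b)
    ∈-rest (no t≮R) = contradiction t<R t≮R

  absorbed∈codes : ∀ j → Free j → inj₂ j ∈ codes
  absorbed∈codes j free = ∈-codes (firstLap∈parts (≤-trans (Finₚ.toℕ<n j) (<⇒≤ R<r)))
    (∈-++⁺ʳ (lowerHalf (suc (toℕ j))) (∈-rest (toℕ j <? R)))
    where
    ∈-absorbed : ∀ {j′} → j′ ≡ j → (d : Dec (Free j′)) → inj₂ j ∈ absorbedIfFree d
    ∈-absorbed refl (yes _)   = here refl
    ∈-absorbed refl (no ¬free) = contradiction free ¬free
    ∈-rest : ∀ d → inj₂ j ∈ firstLapRest (toℕ j) d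
    ∈-rest (yes j<R) = ∈-++⁺ʳ (upperHalf _) (∈-absorbed (Finₚ.fromℕ<-toℕ j j<R) _)
    ∈-rest (no j≮R)  = contradiction (Finₚ.toℕ<n j) j≮R

  codes-complete : ∀ c → Valid c → c ∈ codes
  codes-complete (inj₁ (i , a)) i≤r with splitAt k a in eq
  ... | inj₁ b rewrite sym (Finₚ.splitAt⁻¹-↑ˡ eq) =
    ∈-codes (firstLap∈parts i≤r) (∈-++⁺ˡ (∈-tabulate⁺ b))
  ... | inj₂ b rewrite sym (Finₚ.splitAt⁻¹-↑ʳ eq) = upper∈codes i b i≤r
  codes-complete (inj₂ j) _ with j ∈? Y₀ | j ∈? X₀
  ... | yes j∈Y₀ | _        = ∈-codes (here refl) (∈-map⁺ inj₂ j∈Y₀)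
  ... | no  _    | yes j∈X₀ = ∈-codes final∈parts (∈-map⁺ inj₂ j∈X₀)
  ... | no  j∉Y₀ | no  j∉X₀ = absorbed∈codes j (j∉Y₀ , j∉X₀)

  ↝⇒≢ : ∀ {c d} → c ↝ d → c ≢ d
  ↝⇒≢ c↝c refl = irrefl H _ c↝c

  codes-valid : All Valid codes
  codes-valid = Allₚ.concat⁺ (Allₚ.map⁺ (All.map (λ {t} adm → All.tabulate (valid-block t adm)) parts-admissible))

  codes-unique : Unique codes
  codes-unique = Unique-concat-by-classifier block partOf parts-unique
    (All.map (λ {t} adm → AllPairs.map ↝⇒≢ (block-ordered t adm)) parts-admissible)
    (All.map (λ {t} adm {c} → partOf-block t adm {c}) parts-admissible)

  codes-pathPower : PathPower codes
  codes-pathPower = PathPower-concat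
    (Allₚ.map⁺ (All.map (λ {t} adm → AllPairs⇒PathPower (block-ordered t adm)) parts-admissible))
    (Allₚ.map⁺ (All.universal k≤length-block parts))
    (Linkedₚ.map⁺ parts-linked)

  vertices : List (Fin n)
  vertices = map vertex codes

  vertices-unique : Unique vertices
  vertices-unique = Unique-map⁺-on vertex-injective codes-valid codes-unique

  vertices-complete : ∀ v → v ∈ vertices
  vertices-complete v with vertex-onto v
  ... | c , valid , refl = ∈-map⁺ vertex (codes-complete c valid)

  vertices-pathPower : PathPowers.PathPower (_⟶_ H) k vertices
  vertices-pathPower = PathPower-map⁺ k codes-pathPower

  initialVertices finalVertices : List (Fin n)
  initialVertices = map vertex (block initial)
  finalVertices   = map vertex (block final)

  vertices≡initial++ : vertices ≡ initialVertices ++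
    map vertex (concat (map block (firstLapOuter ++ firstLapInner ++ secondLapOuter ++ secondLap 0 ∷ final ∷ [])))
  vertices≡initial++ = map-++ vertex (block initial) _

  vertices≡++final : vertices ≡ map vertex (concat (map block (initial ∷ middle))) ++ finalVertices
  vertices≡++final = begin
    map vertex (concat (map block parts))                            ≡⟨ cong (map vertex ∘ concat ∘ map block) parts≡ ⟩
    map vertex (concat (map block ((initial ∷ middle) ++ final ∷ []))) ≡⟨ cong (map vertex ∘ concat) (map-++ block (initial ∷ middle) _) ⟩
    map vertex (concat (map block (initial ∷ middle) ++ block final ∷ [])) ≡⟨ cong (map vertex) (concat-++ (map block (initial ∷ middle)) _) ⟨
    map vertex (concat (map block (initial ∷ middle)) ++ block final ++ []) ≡⟨ cong (λ xs → map vertex (concat (map block (initial ∷ middle)) ++ xs)) (++-identityʳ (block final)) ⟩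
    map vertex (concat (map block (initial ∷ middle)) ++ block final)       ≡⟨ map-++ vertex _ (block final) ⟩
    map vertex (concat (map block (initial ∷ middle))) ++ finalVertices     ∎
    where open ≡-Reasoning

  length-initialVertices : length initialVertices ≡ k
  length-initialVertices = trans (length-map vertex (block initial)) (trans (length-map inj₂ Y₀) length-Y₀)

  length-finalVertices : length finalVertices ≡ k
  length-finalVertices = trans (length-map vertex (block final)) (trans (length-map inj₂ X₀) length-X₀)

  initialVertices⊆Y : All (_∈ₛ Y) initialVertices
  initialVertices⊆Y = Allₚ.map⁺ (Allₚ.map⁺ (Allₚ.tabulate⁺ (λ a → QY.q-qIndex∈ (a ↑ˡ k))))

  finalVertices⊆X : All (_∈ₛ X) finalVertices
  finalVertices⊆X = Allₚ.map⁺ (Allₚ.map⁺ (All.tabulate λ j∈ → q∈X (proj₁ (X₀⊆X-Y₀ j∈))))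
    where
    q∈X : ∀ {j} → j ∈ tabulate QX.qIndex → q j ∈ₛ X
    q∈X j∈ with ∈-tabulate⁻ j∈
    ... | a , refl = QX.q-qIndex∈ a

open import Data.Fin.Subset using (_∈_)

proposition2p13 : (k n : ℕ) (H : Tournament n) (A : Absorber H k)
    → (X Y : Subset n)
    → image H (Absorber.q A) X → image H (Absorber.q A) Y
    → ∣ X ∣ ≡ 2 * k → ∣ Y ∣ ≡ 2 * k
    → InducesTransitive H X → InducesTransitive H Y
    → Σ (Fin n → Fin n) λ x → IsHamiltonPathPower H k x
        × (∀ i → toℕ i < k → x i ∈ Y)
        × (∀ i → n ≤ toℕ i + k → x i ∈ X)
proposition2p13 k n H A X Y X⊆Q Y⊆Q ∣X∣ ∣Y∣ X-transitive Y-transitive =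
  path , (path-injective , path-surjective , path-edges vertices-pathPower) , startsInY , endsInX
  where
  open AbsorberPath k n H A X Y X⊆Q Y⊆Q ∣X∣ ∣Y∣ X-transitive Y-transitive
  open FromList H k vertices vertices-unique vertices-complete

  startsInY : ∀ i → toℕ i < k → path i ∈ Y
  startsInY i i<k = All.lookup initialVertices⊆Y
    (path-prefix initialVertices vertices≡initial++ i (subst (toℕ i <_) (sym length-initialVertices) i<k))

  endsInX : ∀ i → n ≤ toℕ i + k → path i ∈ X
  endsInX i n≤i+k = All.lookup finalVertices⊆X
    (path-suffix finalVertices vertices≡++final i (subst (λ m → n ≤ toℕ i + m) (sym length-finalVertices) n≤i+k))
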